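{- The class of MG-definable sets of valuations is effectively closed under complementation: given a finite set $\{M_0,\dots,M_j\}$ of monotonicity graphs over $(\mathit{Var},\mathit{Const})$, one can compute a finite set $\{N_0,\dots,N_l\}$ of monotonicity graphs with $\mathit{Val}\setminus\bigcup_i \mathit{Sat}(M_i)=\bigcup_i\mathit{Sat}(N_i)$.
   Context: Fix finite sets $\mathit{Var}$ of variables and $\mathit{Const}\subseteq\mathbb{Z}$ of constants; $\mathit{Val}$ is the set of valuations $\nu:\mathit{Var}\to\mathbb{Z}$, extended by $\nu(c)=c$ for $c\in\mathit{Const}$. A monotonicity graph (MG) over $(\mathit{Var},\mathit{Const})$ is a finite directed graph with node set $\mathit{Var}\cup\mathit{Const}$ whose edges carry weights in $\mathbb{Z}\cup\{ -\infty,\infty\}$. A valuation $\nu$ satisfies $M$ if for every edge $x\xrightarrow{k}y$ we have $\nu(x)-\nu(y)\ge k$; $\mathit{Sat}(M)$ is the set of such valuations. A set $S\subseteq\mathit{Val}$ is MG-definable if $S=\bigcup_{i\le j}\mathit{Sat}(M_i)$ for some finite set of MGs $M_0,\dots,M_j$. -}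

module Defs where

open import Data.Nat using (ℕ)
open import Data.Fin using (Fin)
open import Data.Integer using (ℤ; _-_; _≤_)
open import Data.Sum using (_⊎_; inj₁; inj₂)
open import Data.Product using (_×_; _,_)
open import Data.List using (List)
open import Data.List.Relation.Unary.All using (All)
open import Data.List.Relation.Unary.Any using (Any)
open import Data.Unit using (⊤)
open import Data.Empty using (⊥)

-- Variables: Var = Fin n.  Constants: Const = image of an injection-free
-- enumeration  cs : Fin m → ℤ  (Const ⊆ ℤ finite).

data Weight : Set where
  -∞  : Weight
  fin : ℤ → Weight
  +∞  : Weight

Node : ℕ → ℕ → Set
Node n m = Fin n ⊎ Fin m

record Edge (n m : ℕ) : Set where
  constructor edge
  field
    src    : Node n m
    weight : Weight
    tgt    : Node n m

MG : ℕ → ℕ → Set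
MG n m = List (Edge n m)

Val : ℕ → Set
Val n = Fin n → ℤ

evalNode : ∀ {n m} → (Fin m → ℤ) → Val n → Node n m → ℤ
evalNode cs ν (inj₁ x) = ν x
evalNode cs ν (inj₂ c) = cs c

_≥w_ : ℤ → Weight → Set
a ≥w -∞    = ⊤
a ≥w fin k = k ≤ a
a ≥w +∞    = ⊥

SatEdge : ∀ {n m} → (Fin m → ℤ) → Val n → Edge n m → Set
SatEdge cs ν (edge x k y) = (evalNode cs ν x - evalNode cs ν y) ≥w k

Sat : ∀ {n m} → (Fin m → ℤ) → MG n m → Val n → Set
Sat cs M ν = All (SatEdge cs ν) M

SatUnion : ∀ {n m} → (Fin m → ℤ) → List (MG n m) → Val n → Set
SatUnion cs Ms ν = Any (λ M → Sat cs M ν) Ms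

module Submission where

open import Defs
open import Data.Nat using (ℕ)
open import Data.Fin using (Fin)
open import Data.Integer using (ℤ)
open import Data.List using (List)
open import Data.Product using (Σ)
open import Relation.Nullary using (¬_)
open import Function.Bundles using (_⇔_)

open import Data.Integer using (_-_; -_; pred; _≤_; _≤?_)
open import Data.Integer.Properties
  using (≰⇒>; <⇒≱; i<j⇒i≤pred[j]; i≤pred[j]⇒i<j; neg-mono-≤; neg-cancel-≤)
open import Data.Integer.Tactic.RingSolver using (solve-∀)
open import Data.List using ([]; _∷_; _++_; map; foldr; cartesianProductWith)
open import Data.List.Relation.Unary.All using ([]; _∷_)
open import Data.List.Relation.Unary.All.Properties using (++⁺; ++⁻; ¬All⇒Any¬; Any¬⇒¬All)
open import Data.List.Relation.Unary.Any using (here; there)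
import Data.List.Relation.Unary.Any as Any
open import Data.List.Relation.Unary.Any.Properties
  using (map⁺; map⁻; cartesianProductWith⁺; cartesianProductWith⁻)
open import Data.Product using (_×_; _,_)
open import Data.Unit using (tt)
open import Data.Empty using (⊥-elim)
open import Function using (_∘_)
open import Function.Bundles using (mk⇔; Equivalence)
open import Relation.Nullary using (yes; no)
open import Relation.Unary using (Decidable)
open import Relation.Binary.PropositionalEquality using (_≡_; sym; subst)

-- A single edge constraint  ν(x) - ν(y) ≥ k  is complemented by one
-- monotonicity graph: over ℤ its negation  ν(x) - ν(y) < k  is the edge
-- y --(1-k)--> x  (for k = -∞ the constraint is always true, so its
-- complement is the unsatisfiable edge of weight +∞; for k = +∞ it is
-- always false, so its complement is the empty graph).
-- Since Sat(M) is the conjunction of its edge constraints, and these are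
-- decidable, the complement of Sat(M) is the union, over the edges of M,
-- of the complements of the single edges.
-- Intersections of finite unions are finite unions again: take all pairwise
-- concatenations of edge lists (distributivity).  Finally
--   Val ∖ ⋃ᵢ Sat(Mᵢ) = ⋂ᵢ (Val ∖ Sat(Mᵢ)),
-- which is a finite union by the two previous facts, the empty intersection
-- being Sat of the empty graph.

-- Over ℤ, a difference a - b fails to reach k exactly when the reversed
-- difference b - a reaches 1 - k, written here as  - pred k.
≰⇔reversed-≤ : ∀ k a b → (¬ k ≤ a - b) ⇔ (- pred k ≤ b - a)
≰⇔reversed-≤ k a b = mk⇔ to from
  where
  reverse : ∀ x y → - (x - y) ≡ y - x
  reverse = solve-∀

  to : ¬ (k ≤ a - b) → - pred k ≤ b - a
  to k≰a-b = subst (- pred k ≤_) (reverse a b) (neg-mono-≤ (i<j⇒i≤pred[j] (≰⇒> k≰a-b)))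

  from : - pred k ≤ b - a → ¬ (k ≤ a - b)
  from p = <⇒≱ (i≤pred[j]⇒i<j (neg-cancel-≤ (subst (- pred k ≤_) (sym (reverse a b)) p)))

module _ {n m : ℕ} (cs : Fin m → ℤ) where

  -- Satisfaction of a single edge is decidable; this is what lets a
  -- violated conjunction Sat(M) point to one violated edge.
  satEdge? : (ν : Val n) → Decidable (SatEdge cs ν)
  satEdge? ν (edge x -∞ y)      = yes tt
  satEdge? ν (edge x (fin k) y) = k ≤? (evalNode cs ν x - evalNode cs ν y)
  satEdge? ν (edge x +∞ y)      = no λ ()

  complEdge : Edge n m → MG n m
  complEdge (edge x -∞ y)      = edge x +∞ y ∷ []
  complEdge (edge x (fin k) y) = edge y (fin (- pred k)) x ∷ []
  complEdge (edge x +∞ y)      = []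

  complEdge-correct : ∀ (ν : Val n) e → Sat cs (complEdge e) ν ⇔ (¬ SatEdge cs ν e)
  complEdge-correct ν (edge x -∞ y)      = mk⇔ (λ { (() ∷ []) }) (λ ¬sat → ⊥-elim (¬sat tt))
  complEdge-correct ν (edge x (fin k) y) = mk⇔ (λ { (p ∷ []) → from p }) (λ ¬p → to ¬p ∷ [])
    where open Equivalence (≰⇔reversed-≤ k (evalNode cs ν x) (evalNode cs ν y))
  complEdge-correct ν (edge x +∞ y)      = mk⇔ (λ _ ()) (λ _ → [])

  complMG : MG n m → List (MG n m)
  complMG M = map complEdge M

  complMG-correct : ∀ (ν : Val n) M → SatUnion cs (complMG M) ν ⇔ (¬ Sat cs M ν)
  complMG-correct ν M = mk⇔
    (Any¬⇒¬All ∘ Any.map (Equivalence.to (complEdge-correct ν _)) ∘ map⁻)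
    (map⁺ ∘ Any.map (Equivalence.from (complEdge-correct ν _)) ∘ ¬All⇒Any¬ (satEdge? ν) M)

  meet : List (MG n m) → List (MG n m) → List (MG n m)
  meet = cartesianProductWith _++_

  meet-correct : ∀ (ν : Val n) Ms Ns →
    SatUnion cs (meet Ms Ns) ν ⇔ (SatUnion cs Ms ν × SatUnion cs Ns ν)
  meet-correct ν Ms Ns = mk⇔
    (cartesianProductWith⁻ _++_ (λ {M} → ++⁻ M) Ms Ns)
    (λ (sMs , sNs) → cartesianProductWith⁺ _++_ ++⁺ sMs sNs)

  compl : List (MG n m) → List (MG n m)
  compl = foldr (meet ∘ complMG) ([] ∷ [])

  compl-correct : ∀ Ms (ν : Val n) → (¬ SatUnion cs Ms ν) ⇔ SatUnion cs (compl Ms) ν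
  compl-correct []       ν = mk⇔ (λ _ → here []) (λ _ ())
  compl-correct (M ∷ Ms) ν = mk⇔ to from
    where
    module Head = Equivalence (complMG-correct ν M)
    module Tail = Equivalence (compl-correct Ms ν)
    module Meet = Equivalence (meet-correct ν (complMG M) (compl Ms))

    to : ¬ SatUnion cs (M ∷ Ms) ν → SatUnion cs (compl (M ∷ Ms)) ν
    to ¬sat = Meet.from (Head.from (¬sat ∘ here) , Tail.to (¬sat ∘ there))

    from : SatUnion cs (compl (M ∷ Ms)) ν → ¬ SatUnion cs (M ∷ Ms) ν
    from sat with Meet.to sat
    ... | notM , notMs = λ { (here sM) → Head.to notM sM ; (there sMs) → Tail.from notMs sMs }

lemma3 : (n m : ℕ) → (cs : Fin m → ℤ) →
    Σ (List (MG n m) → List (MG n m)) (λ compl →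
      (Ms : List (MG n m)) → (ν : Val n) →
        (¬ SatUnion cs Ms ν) ⇔ SatUnion cs (compl Ms) ν)
lemma3 n m cs = compl cs , compl-correct cs
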